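{- For every nontrivial connected graph $G$, $tpc(G)>pvc(G)$.
   Context: All graphs are simple, finite and undirected. A graph is total-colored if every vertex and every edge receives a color. A path $v_1v_2\ldots v_s$ in a total-colored graph is a total proper path if (i) any two adjacent edges on the path have different colors, (ii) any two adjacent internal vertices of the path (vertices among $v_2,\ldots,v_{s-1}$) have different colors, and (iii) every internal vertex of the path has a color different from the colors of its two incident edges on the path. A total-colored graph is total proper connected if every two vertices are joined by a total proper path. For a connected graph $G$, the total proper connection number $tpc(G)$ is the smallest number of colors in a total-coloring making $G$ total proper connected. In a vertex-colored graph, a path is vertex-proper if any two adjacent internal vertices of the path have different colors; a vertex-colored graph is proper vertex connected if every two vertices are joined by a vertex-proper path. For a connected graph $G$, the proper vertex connection number $pvc(G)$ is the smallest number of colors in a vertex-coloring making $G$ proper vertex connected, with the convention $pvc(G)=0$ when $G$ is complete. -}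

module Defs where

open import Data.Nat using (ℕ; _≤_; _<_)
open import Data.Fin using (Fin)
open import Data.Bool using (Bool; true)
open import Data.List using (List; []; _∷_; head; last)
open import Data.List.Relation.Unary.Unique.Propositional using (Unique)
open import Data.Maybe using (just)
open import Data.Product using (_×_; ∃)
open import Data.Sum using (_⊎_)
open import Data.Unit using (⊤)
open import Relation.Nullary using (¬_)
open import Relation.Binary.PropositionalEquality using (_≡_; _≢_)

record Graph (n : ℕ) : Set where
  field
    adj   : Fin n → Fin n → Bool
    sym   : ∀ u v → adj u v ≡ adj v u
    irrefl : ∀ v → ¬ (adj v v ≡ true)
open Graph public

module _ {n : ℕ} (G : Graph n) where

  Chain : List (Fin n) → Set
  Chain []            = ⊤
  Chain (_ ∷ [])      = ⊤
  Chain (x ∷ y ∷ r)   = (adj G x y ≡ true) × Chain (y ∷ r)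

  IsPath : Fin n → Fin n → List (Fin n) → Set
  IsPath u v p = Unique p × Chain p × head p ≡ just u × last p ≡ just v

  Connected : Set
  Connected = ∀ u v → ∃ λ p → IsPath u v p

  Complete : Set
  Complete = ∀ u v → u ≢ v → adj G u v ≡ true

-- A total coloring with (at most) k colors: colors of vertices and of
-- edges; the edge coloring is given as a symmetric function on pairs
-- (its values on non-adjacent pairs are irrelevant).
record TotalColoring (n k : ℕ) : Set where
  field
    vcol : Fin n → Fin k
    ecol : Fin n → Fin n → Fin k
    ecol-sym : ∀ u v → ecol u v ≡ ecol v u
open TotalColoring public

InternalProper : {n k : ℕ} → (Fin n → Fin k) → List (Fin n) → Set
InternalProper c (a ∷ b ∷ d ∷ f ∷ r) = (c b ≢ c d) × InternalProper c (b ∷ d ∷ f ∷ r)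
InternalProper c _ = ⊤

EdgeProper : {n k : ℕ} → TotalColoring n k → List (Fin n) → Set
EdgeProper χ (a ∷ b ∷ d ∷ r) =
  (ecol χ a b ≢ ecol χ b d) × (vcol χ b ≢ ecol χ a b) × (vcol χ b ≢ ecol χ b d)
  × EdgeProper χ (b ∷ d ∷ r)
EdgeProper χ _ = ⊤

TotalProperPath : {n k : ℕ} → TotalColoring n k → List (Fin n) → Set
TotalProperPath χ p = EdgeProper χ p × InternalProper (vcol χ) p

TotalProperConnected : {n k : ℕ} → Graph n → TotalColoring n k → Set
TotalProperConnected G χ = ∀ u v → ∃ λ p → IsPath G u v p × TotalProperPath χ p

ProperVertexConnected : {n k : ℕ} → Graph n → (Fin n → Fin k) → Set
ProperVertexConnected G c = ∀ u v → ∃ λ p → IsPath G u v p × InternalProper c p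

IsTpc : {n : ℕ} → Graph n → ℕ → Set
IsTpc {n} G t =
  (∃ λ (χ : TotalColoring n t) → TotalProperConnected G χ)
  × (∀ k → (χ : TotalColoring n k) → TotalProperConnected G χ → t ≤ k)

-- p = pvc(G), with convention pvc(G) = 0 for complete G
IsPvc : {n : ℕ} → Graph n → ℕ → Set
IsPvc {n} G p =
  (Complete G × p ≡ 0)
  ⊎ (¬ Complete G
     × (∃ λ (c : Fin n → Fin p) → ProperVertexConnected G c)
     × (∀ k → (c : Fin n → Fin k) → ProperVertexConnected G c → p ≤ k))

-- With two colours an internal vertex and its two path edges cannot receive three distinct
-- colours, so a total proper path with at most two colours is a single edge: tpc(G) ≤ 2 forces
-- G to be complete, and for complete G, pvc(G) = 0 < tpc(G). On the other hand, every connected graph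
-- has pvc(G) ≤ 2: colour each vertex by the parity of its distance to a root. Then every vertex
-- reaches the root along a breadth-first walk whose colours alternate, any two vertices are joined
-- by such a walk through the root, and removing cycles turns it into a path.
module Submission where

open import Defs
open import Data.Nat using (ℕ; zero; suc; _≤_; _<_; _≤′_; ≤′-reflexive; ≤′-step; s≤s; z≤n; >-nonZero⁻¹)
open import Data.Nat.Properties using (≤-antisym; ≤-<-trans; ≰⇒>; ≤⇒≤′; 1+n≰n; ≤-pred)
open import Data.Fin using (Fin; zero; suc; _≟_)
open import Data.Fin.Properties using (any?; pigeonhole; nonZeroIndex)
open import Data.Bool using (true) renaming (_≟_ to _≟ᵇ_)
open import Data.Vec using ([]; _∷_; lookup)
open import Data.List using (List; []; _∷_; head; last)
open import Data.List.Membership.Propositional using (_∈_)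
open import Data.List.Relation.Unary.Any using (here; there)
open import Data.List.Relation.Unary.All using ([])
open import Data.List.Relation.Unary.AllPairs using ([]; _∷_)
open import Data.List.Relation.Unary.All.Properties using (¬Any⇒All¬)
open import Data.List.Relation.Unary.Linked as Linked using (Linked; []; [-]; _∷_)
open import Data.List.Relation.Unary.Unique.Propositional using (Unique)
open import Data.Maybe using (just)
open import Data.Product using (Σ; ∃; _×_; _,_; proj₁; proj₂)
open import Data.Sum using (_⊎_; inj₁; inj₂)
open import Data.Empty using (⊥; ⊥-elim)
open import Data.Unit using (tt)
open import Function using (_∘_)
open import Relation.Binary using (Rel; DecidableEquality; Sym)
open import Relation.Binary.Construct.Closure.ReflexiveTransitive using (Star; ε; _◅_; _◅◅_; reverse)
open import Relation.Nullary using (yes; no)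
open import Relation.Nullary.Decidable using (_⊎-dec_; _×-dec_)
open import Relation.Unary using (Decidable)
open import Relation.Binary.PropositionalEquality using (_≡_; _≢_; refl; trans; ≢-sym; subst)

module Walks {a ℓ} {A : Set a} (_≟A_ : DecidableEquality A) {R : Rel A ℓ} where
  open import Data.List.Membership.DecPropositional _≟A_ using (_∈?_)

  vertices : ∀ {x y} → Star R x y → List A
  vertices {x} ε       = x ∷ []
  vertices {x} (_ ◅ w) = x ∷ vertices w

  vertices-linked : ∀ {x y} (w : Star R x y) → Linked R (vertices w)
  vertices-linked ε                = [-]
  vertices-linked (r ◅ ε)          = r ∷ [-]
  vertices-linked (r ◅ w@(_ ◅ _)) = r ∷ vertices-linked w

  head-vertices : ∀ {x y} (w : Star R x y) → head (vertices w) ≡ just x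
  head-vertices ε       = refl
  head-vertices (_ ◅ _) = refl

  last-vertices : ∀ {x y} (w : Star R x y) → last (vertices w) ≡ just y
  last-vertices ε                = refl
  last-vertices (_ ◅ ε)          = refl
  last-vertices (_ ◅ w@(_ ◅ _)) = last-vertices w

  dropUntil : ∀ {x y z} (w : Star R y z) → x ∈ vertices w → Star R x z
  dropUntil ε         (here refl) = ε
  dropUntil w@(_ ◅ _) (here refl) = w
  dropUntil (_ ◅ w)   (there x∈w) = dropUntil w x∈w

  dropUntil-unique : ∀ {x y z} (w : Star R y z) (x∈w : x ∈ vertices w) →
                     Unique (vertices w) → Unique (vertices (dropUntil w x∈w))
  dropUntil-unique ε       (here refl) u       = u
  dropUntil-unique (_ ◅ _) (here refl) u       = u
  dropUntil-unique (_ ◅ w) (there x∈w) (_ ∷ u) = dropUntil-unique w x∈w u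

  shortcut : ∀ {x y} → Star R x y → Σ (Star R x y) (Unique ∘ vertices)
  shortcut ε = ε , [] ∷ []
  shortcut {x} (r ◅ w) with shortcut w
  ... | p , u with x ∈? vertices p
  ...   | yes x∈p = dropUntil p x∈p , dropUntil-unique p x∈p u
  ...   | no  x∉p = r ◅ p , ¬Any⇒All¬ (vertices p) x∉p ∷ u

  star⇒linkedPath : ∀ {x y} → Star R x y →
    ∃ λ p → Unique p × Linked R p × head p ≡ just x × last p ≡ just y
  star⇒linkedPath w with shortcut w
  ... | p , u = vertices p , u , vertices-linked p , head-vertices p , last-vertices p

Adjacent : ∀ {n} → Graph n → Rel (Fin n) _
Adjacent G u v = adj G u v ≡ true

linked⇒chain : ∀ {n} (G : Graph n) {p} → Linked (Adjacent G) p → Chain G p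
linked⇒chain G []              = tt
linked⇒chain G [-]             = tt
linked⇒chain G (a ∷ [-])       = a , tt
linked⇒chain G (a ∷ l@(_ ∷ _)) = a , linked⇒chain G l

linked⇒internalProper : ∀ {n k} (c : Fin n → Fin k) {p} →
  Linked (λ u v → c u ≢ c v) p → InternalProper c p
linked⇒internalProper c []                    = tt
linked⇒internalProper c [-]                   = tt
linked⇒internalProper c (_ ∷ [-])             = tt
linked⇒internalProper c (_ ∷ _ ∷ [-])         = tt
linked⇒internalProper c (_ ∷ l@(b≢d ∷ _ ∷ _)) = b≢d , linked⇒internalProper c l

module _ {n k} (G : Graph n) (c : Fin n → Fin k) where

  Alternating : Rel (Fin n) _
  Alternating u v = Adjacent G u v × c u ≢ c v

  alternating-sym : Sym Alternating Alternating
  alternating-sym {u} {v} (a , c≢) = trans (Graph.sym G v u) a , ≢-sym c≢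

  open Walks _≟_ {R = Alternating} using (star⇒linkedPath)

  alternatingHub⇒properVertexConnected : (r : Fin n) → (∀ v → Star Alternating v r) →
    ProperVertexConnected G c
  alternatingHub⇒properVertexConnected r toHub u v
    with star⇒linkedPath (toHub u ◅◅ reverse alternating-sym (toHub v))
  ... | p , unique , l , hd , lt =
    p , (unique , linked⇒chain G (Linked.map proj₁ l) , hd , lt) ,
    linked⇒internalProper c (Linked.map proj₂ l)

parity : ℕ → Fin 2
parity zero          = zero
parity (suc zero)    = suc zero
parity (suc (suc k)) = parity k

parity-suc : ∀ k → parity (suc k) ≢ parity k
parity-suc zero    ()
parity-suc (suc k) = ≢-sym (parity-suc k)

module BreadthFirst {n} (G : Graph n) (r : Fin n) (conn : Connected G) where

  Within : ℕ → Fin n → Set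
  Within zero    v = v ≡ r
  Within (suc k) v = Within k v ⊎ ∃ λ w → Within k w × Adjacent G w v

  within? : ∀ k → Decidable (Within k)
  within? zero    v = v ≟ r
  within? (suc k) v = within? k v ⊎-dec any? (λ w → within? k w ×-dec (adj G w v ≟ᵇ true))

  within-mono′ : ∀ {j k v} → j ≤′ k → Within j v → Within k v
  within-mono′ (≤′-reflexive refl) h = h
  within-mono′ (≤′-step j≤k)      h = inj₁ (within-mono′ j≤k h)

  chain⇒within : ∀ {k x v} xs → Within k x → Chain G (x ∷ xs) → last (x ∷ xs) ≡ just v →
                 ∃ λ j → Within j v
  chain⇒within {k} []       h _        refl = k , h
  chain⇒within     (y ∷ ys) h (a , ch) lt   = chain⇒within ys (inj₂ (_ , h , a)) ch lt

  reachable : ∀ v → ∃ λ k → Within k v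
  reachable v with conn r v
  ... | x ∷ xs , _ , ch , refl , lt = chain⇒within xs refl ch lt

  Distance : Fin n → ℕ → Set
  Distance v d = Within d v × (∀ j → Within j v → d ≤ j)

  distance : ∀ k v → Within k v → ∃ (Distance v)
  distance zero    v h = 0 , h , λ _ _ → z≤n
  distance (suc k) v h with within? k v
  ... | yes h′ = distance k v h′
  ... | no ¬h  = suc k , h , λ j hj → ≰⇒> (λ j≤k → ¬h (within-mono′ (≤⇒≤′ j≤k) hj))

  dist : Fin n → ℕ
  dist v = proj₁ (distance _ v (proj₂ (reachable v)))

  dist-spec : ∀ v → Distance v (dist v)
  dist-spec v = proj₂ (distance _ v (proj₂ (reachable v)))

  parent : ∀ {k} v → dist v ≡ suc k → ∃ λ w → Adjacent G w v × dist w ≡ k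
  parent {k} v eq with dist-spec v
  ... | hv , minv rewrite eq with hv
  ...   | inj₁ hk = ⊥-elim (1+n≰n (minv k hk))
  ...   | inj₂ (w , hw , a) with dist-spec w
  ...     | hw′ , minw =
    w , a , ≤-antisym (minw k hw) (≤-pred (minv _ (inj₂ (w , hw′ , a))))

  colour : Fin n → Fin 2
  colour = parity ∘ dist

  toRoot : ∀ k v → dist v ≡ k → Star (Alternating G colour) v r
  toRoot zero    v eq with subst (λ d → Within d v) eq (proj₁ (dist-spec v))
  ... | refl = ε
  toRoot (suc k) v eq with parent v eq
  ... | w , a , dw = (trans (Graph.sym G v w) a , colours-differ) ◅ toRoot k w dw
    where
    colours-differ : colour v ≢ colour w
    colours-differ rewrite eq | dw = parity-suc k

connected⇒properVertexConnected-2 : ∀ {n} (G : Graph n) → Fin n → Connected G →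
  ∃ λ (c : Fin n → Fin 2) → ProperVertexConnected G c
connected⇒properVertexConnected-2 G r conn =
  colour , alternatingHub⇒properVertexConnected G colour r (λ v → toRoot _ v refl)
  where open BreadthFirst G r conn

no-three-distinct : ∀ {t} → t ≤ 2 → (a b c : Fin t) → a ≢ b → a ≢ c → b ≢ c → ⊥
no-three-distinct t≤2 a b c a≢b a≢c b≢c with pigeonhole (s≤s t≤2) (lookup (a ∷ b ∷ c ∷ []))
... | zero           , suc zero       , _ , eq = a≢b eq
... | zero           , suc (suc zero) , _ , eq = a≢c eq
... | suc zero       , suc (suc zero) , _ , eq = b≢c eq
... | suc zero       , suc zero       , s≤s () , _
... | suc (suc zero) , suc (suc zero) , s≤s (s≤s ()) , _

totalProperConnected⇒complete : ∀ {n t} (G : Graph n) (χ : TotalColoring n t) → t ≤ 2 →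
  TotalProperConnected G χ → Complete G
totalProperConnected⇒complete G χ t≤2 tpc u v u≢v with tpc u v
... | x ∷ [] , (_ , _ , refl , refl) , _ = ⊥-elim (u≢v refl)
... | x ∷ y ∷ [] , (_ , (a , _) , refl , refl) , _ = a
... | x ∷ y ∷ z ∷ _ , _ , (e≢e′ , c≢e , c≢e′ , _) , _ =
  ⊥-elim (no-three-distinct t≤2 (ecol χ x y) (ecol χ y z) (vcol χ y) e≢e′ (≢-sym c≢e) (≢-sym c≢e′))

mainTheorem13 : ∀ {n : ℕ} (G : Graph n) → 2 ≤ n → Connected G →
    ∀ (t p : ℕ) → IsTpc G t → IsPvc G p → p < t
mainTheorem13 G (s≤s _) conn t p ((χ , _) , _) (inj₁ (_ , refl)) =
  >-nonZero⁻¹ t {{nonZeroIndex (vcol χ zero)}}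
mainTheorem13 G (s≤s _) conn t p ((χ , tpc) , _) (inj₂ (¬complete , _ , minimal))
  with connected⇒properVertexConnected-2 G zero conn
... | c , pvc = ≤-<-trans (minimal 2 c pvc)
                          (≰⇒> (λ t≤2 → ¬complete (totalProperConnected⇒complete G χ t≤2 tpc)))
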